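{- $LTS(\mathrm{CLL}_R)$ is $\tau$-pure: for every process $p$, if $p\stackrel{\tau}{\longrightarrow}q$ for some $q$, then there is no $a\in Act$ and no $q'$ with $p\stackrel{a}{\longrightarrow}q'$.
   Context: Fix a set $Act$ of visible actions and let $Act_\tau=Act\cup\{\tau\}$; $a$ ranges over $Act$, $\alpha$ over $Act_\tau$. Terms of $\mathrm{CLL}_R$: $t::=0\mid\bot\mid\alpha.t\mid t\Box t\mid t\wedge t\mid t\vee t\mid t\parallel_A t\mid X\mid\langle X|E\rangle$, where $X$ is a variable, $A\subseteq Act$, and $E$ is a recursive specification, i.e. a finite nonempty set of equations $\{Y=t_Y:Y\in V\}$ over a set $V$ of variables with $X\in V$ (variables of $V$ are bound in $\langle X|E\rangle$; recursive variables of distinct specifications are distinct and never occur free). A process is a closed term. For $E$ over $V$, $\langle t|E\rangle$ is $t$ with every free occurrence of each $Y\in V$ replaced by $\langle Y|E\rangle$. All recursive specifications are assumed guarded: every occurrence of every $Y\in V$ in every right-hand side of $E$ lies within a subterm $\alpha.t'$ or $t_1\vee t_2$. $LTS(\mathrm{CLL}_R)$ has the processes as states, transitions $\stackrel{\alpha}{\longrightarrow}$ and inconsistency predicate $F$ given by the unique stable model of the following stratified transition system specification ($x\not\stackrel{\alpha}{\longrightarrow}$: no $\alpha$-transition; $z\stackrel{\epsilon}{\Longrightarrow}|y$: $z(\stackrel{\tau}{\longrightarrow})^*y$ and $y\not\stackrel{\tau}{\longrightarrow}$). Operational rules: $\alpha.x\stackrel{\alpha}{\to}x$; if $x_1\stackrel{a}{\to}y_1$,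 $x_2\not\stackrel{\tau}{\to}$ then $x_1\Box x_2\stackrel a\to y_1$ and $x_2\Box x_1\stackrel a\to y_1$; if $x_1\stackrel\tau\to y_1$ then $x_1\Box x_2\stackrel\tau\to y_1\Box x_2$, $x_2\Box x_1\stackrel\tau\to x_2\Box y_1$, $x_1\wedge x_2\stackrel\tau\to y_1\wedge x_2$, $x_2\wedge x_1\stackrel\tau\to x_2\wedge y_1$, $x_1\parallel_A x_2\stackrel\tau\to y_1\parallel_A x_2$, $x_2\parallel_A x_1\stackrel\tau\to x_2\parallel_A y_1$; if $x_1\stackrel a\to y_1$, $x_2\stackrel a\to y_2$ then $x_1\wedge x_2\stackrel a\to y_1\wedge y_2$, and if also $a\in A$ then $x_1\parallel_A x_2\stackrel a\to y_1\parallel_A y_2$; if $a\notin A$, $x_1\stackrel a\to y_1$, $x_2\not\stackrel\tau\to$ then $x_1\parallel_A x_2\stackrel a\to y_1\parallel_A x_2$ and $x_2\parallel_A x_1\stackrel a\to x_2\parallel_A y_1$; $x_1\vee x_2\stackrel\tau\to x_1$, $x_1\vee x_2\stackrel\tau\to x_2$; if $Y=t_Y\in E$ and $\langle t_Y|E\rangle\stackrel\alpha\to y$ then $\langle Y|E\rangle\stackrel\alpha\to y$. Predicate rules: $\bot\in F$; $x\in F\Rightarrow\alpha.x\in F$; $x_1,x_2\in F\Rightarrow x_1\vee x_2\in F$; if $x_1\in F$ or $x_2\in F$ then $x_1\Box x_2, x_1\parallel_A x_2, x_1\wedge x_2\in F$; if $x_1\wedge x_2\not\stackrel\tau\to$ and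 one of $x_1,x_2$ has an $a$-transition while the other has none, then $x_1\wedge x_2\in F$; if $x_1\wedge x_2\stackrel\alpha\to z$ for some $z$ and all $y$ with $x_1\wedge x_2\stackrel\alpha\to y$ are in $F$, then $x_1\wedge x_2\in F$; if all $y$ with $x_1\wedge x_2\stackrel\epsilon\Longrightarrow|y$ are in $F$ then $x_1\wedge x_2\in F$; if $Y=t_Y\in E$ and $\langle t_Y|E\rangle\in F$ then $\langle Y|E\rangle\in F$; if all $y$ with $\langle Y|E\rangle\stackrel\epsilon\Longrightarrow|y$ are in $F$ then $\langle Y|E\rangle\in F$. -}

module Defs where

open import Data.Nat using (ℕ; _≡ᵇ_)
open import Data.Bool using (Bool; true; false; _∧_; _∨_; not; if_then_else_)
open import Data.List using (List; []; _∷_; map)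
open import Data.Product using (_×_; _,_; proj₁; ∃)
open import Data.Empty using (⊥)
open import Relation.Nullary using (¬_)
open import Relation.Binary.PropositionalEquality using (_≡_)
open import Relation.Binary.Construct.Closure.ReflexiveTransitive using (Star)
open import Data.List.Membership.Propositional using (_∈_)
open import Function.Bundles using (_⇔_)

module CLL (Act : Set) where

  data Lab : Set where
    τ   : Lab
    vis : Act → Lab

  Var : Set
  Var = ℕ

  -- Terms of CLL_R.  A recursive specification E is a finite list of
  -- equations (Y , t_Y).  A synchronisation set A ⊆ Act is given by its
  -- characteristic function.
  data Term : Set where
    nil  : Term
    bot  : Term
    pre  : Lab → Term → Term
    ext  : Term → Term → Term
    conj : Term → Term → Term
    disj : Term → Term → Term
    par  : (Act → Bool) → Term → Term → Term
    var  : Var → Term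
    rec  : Var → List (Var × Term) → Term

  Spec : Set
  Spec = List (Var × Term)

  dom : Spec → List Var
  dom = map proj₁

  _∈ᵇ_ : Var → List Var → Bool
  x ∈ᵇ []       = false
  x ∈ᵇ (y ∷ ys) = (x ≡ᵇ y) ∨ (x ∈ᵇ ys)

  -- ⟨t | E⟩ : replace every free occurrence of Y ∈ dom E by ⟨Y | E⟩.
  -- 'blk' records variables bound by enclosing inner specifications.
  mutual
    subB : Spec → (Var → Bool) → Term → Term
    subB E blk nil          = nil
    subB E blk bot          = bot
    subB E blk (pre α t)    = pre α (subB E blk t)
    subB E blk (ext t u)    = ext (subB E blk t) (subB E blk u)
    subB E blk (conj t u)   = conj (subB E blk t) (subB E blk u)
    subB E blk (disj t u)   = disj (subB E blk t) (subB E blk u)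
    subB E blk (par A t u)  = par A (subB E blk t) (subB E blk u)
    subB E blk (var X)      =
      if (X ∈ᵇ dom E) ∧ not (blk X) then rec X E else var X
    subB E blk (rec X E')   = rec X (subSpec E (λ Y → blk Y ∨ (Y ∈ᵇ dom E')) E')

    subSpec : Spec → (Var → Bool) → Spec → Spec
    subSpec E blk []             = []
    subSpec E blk ((Y , t) ∷ E') = (Y , subB E blk t) ∷ subSpec E blk E'

  ⟨_∣_⟩ : Term → Spec → Term
  ⟨ t ∣ E ⟩ = subB E (λ _ → false) t

  mutual
    closedUnder : (Var → Bool) → Term → Bool
    closedUnder b nil         = true
    closedUnder b bot         = true
    closedUnder b (pre α t)   = closedUnder b t
    closedUnder b (ext t u)   = closedUnder b t ∧ closedUnder b u
    closedUnder b (conj t u)  = closedUnder b t ∧ closedUnder b u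
    closedUnder b (disj t u)  = closedUnder b t ∧ closedUnder b u
    closedUnder b (par A t u) = closedUnder b t ∧ closedUnder b u
    closedUnder b (var X)     = b X
    closedUnder b (rec X E)   = closedSpec (λ Y → b Y ∨ (Y ∈ᵇ dom E)) E

    closedSpec : (Var → Bool) → Spec → Bool
    closedSpec b []            = true
    closedSpec b ((_ , t) ∷ E) = closedUnder b t ∧ closedSpec b E

  mutual
    guardedIn : (Var → Bool) → Term → Bool
    guardedIn V nil         = true
    guardedIn V bot         = true
    guardedIn V (pre α t)   = true
    guardedIn V (disj t u)  = true
    guardedIn V (ext t u)   = guardedIn V t ∧ guardedIn V u
    guardedIn V (conj t u)  = guardedIn V t ∧ guardedIn V u
    guardedIn V (par A t u) = guardedIn V t ∧ guardedIn V u
    guardedIn V (var X)     = not (V X)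
    guardedIn V (rec X E)   = guardedSpec (λ Y → V Y ∧ not (Y ∈ᵇ dom E)) E

    guardedSpec : (Var → Bool) → Spec → Bool
    guardedSpec V []            = true
    guardedSpec V ((_ , t) ∷ E) = guardedIn V t ∧ guardedSpec V E

  nodup : List Var → Bool
  nodup []       = true
  nodup (x ∷ xs) = not (x ∈ᵇ xs) ∧ nodup xs

  mutual
    wfSpecs : Term → Bool
    wfSpecs nil         = true
    wfSpecs bot         = true
    wfSpecs (pre α t)   = wfSpecs t
    wfSpecs (ext t u)   = wfSpecs t ∧ wfSpecs u
    wfSpecs (conj t u)  = wfSpecs t ∧ wfSpecs u
    wfSpecs (disj t u)  = wfSpecs t ∧ wfSpecs u
    wfSpecs (par A t u) = wfSpecs t ∧ wfSpecs u
    wfSpecs (var X)     = true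
    wfSpecs (rec X E)   =
      (X ∈ᵇ dom E) ∧ nodup (dom E)
      ∧ guardedSpec (λ Y → Y ∈ᵇ dom E) E ∧ wfSpecList E

    wfSpecList : Spec → Bool
    wfSpecList []            = true
    wfSpecList ((_ , t) ∷ E) = wfSpecs t ∧ wfSpecList E

  IsProcess : Term → Set
  IsProcess t = (closedUnder (λ _ → false) t ∧ wfSpecs t) ≡ true

  -- The transition system specification, reduct w.r.t. a candidate
  -- transition relation T (used to evaluate negative premises).

  TransRel : Set₁
  TransRel = Term → Lab → Term → Set

  Stable : TransRel → Term → Set
  Stable T x = ∀ y → ¬ T x τ y

  WeakStable : TransRel → Term → Term → Set
  WeakStable T z y = Star (λ u v → T u τ v) z y × Stable T y

  data Step (T : TransRel) : Term → Lab → Term → Set where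
    r-pre   : ∀ {α x} → Step T (pre α x) α x
    r-extL  : ∀ {a x₁ x₂ y₁} → Step T x₁ (vis a) y₁ → Stable T x₂ →
              Step T (ext x₁ x₂) (vis a) y₁
    r-extR  : ∀ {a x₁ x₂ y₁} → Step T x₁ (vis a) y₁ → Stable T x₂ →
              Step T (ext x₂ x₁) (vis a) y₁
    r-extτL : ∀ {x₁ x₂ y₁} → Step T x₁ τ y₁ → Step T (ext x₁ x₂) τ (ext y₁ x₂)
    r-extτR : ∀ {x₁ x₂ y₁} → Step T x₁ τ y₁ → Step T (ext x₂ x₁) τ (ext x₂ y₁)
    r-conjτL : ∀ {x₁ x₂ y₁} → Step T x₁ τ y₁ → Step T (conj x₁ x₂) τ (conj y₁ x₂)
    r-conjτR : ∀ {x₁ x₂ y₁} → Step T x₁ τ y₁ → Step T (conj x₂ x₁) τ (conj x₂ y₁)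
    r-parτL : ∀ {A x₁ x₂ y₁} → Step T x₁ τ y₁ →
              Step T (par A x₁ x₂) τ (par A y₁ x₂)
    r-parτR : ∀ {A x₁ x₂ y₁} → Step T x₁ τ y₁ →
              Step T (par A x₂ x₁) τ (par A x₂ y₁)
    r-conj  : ∀ {a x₁ x₂ y₁ y₂} → Step T x₁ (vis a) y₁ → Step T x₂ (vis a) y₂ →
              Step T (conj x₁ x₂) (vis a) (conj y₁ y₂)
    r-sync  : ∀ {A a x₁ x₂ y₁ y₂} → A a ≡ true →
              Step T x₁ (vis a) y₁ → Step T x₂ (vis a) y₂ →
              Step T (par A x₁ x₂) (vis a) (par A y₁ y₂)
    r-parL  : ∀ {A a x₁ x₂ y₁} → A a ≡ false →
              Step T x₁ (vis a) y₁ → Stable T x₂ →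
              Step T (par A x₁ x₂) (vis a) (par A y₁ x₂)
    r-parR  : ∀ {A a x₁ x₂ y₁} → A a ≡ false →
              Step T x₁ (vis a) y₁ → Stable T x₂ →
              Step T (par A x₂ x₁) (vis a) (par A x₂ y₁)
    r-disjL : ∀ {x₁ x₂} → Step T (disj x₁ x₂) τ x₁
    r-disjR : ∀ {x₁ x₂} → Step T (disj x₁ x₂) τ x₂
    r-rec   : ∀ {Y tY E α y} → (Y , tY) ∈ E → Step T ⟨ tY ∣ E ⟩ α y →
              Step T (rec Y E) α y

  data Incons (T : TransRel) : Term → Set where
    f-bot    : Incons T bot
    f-pre    : ∀ {α x} → Incons T x → Incons T (pre α x)
    f-disj   : ∀ {x₁ x₂} → Incons T x₁ → Incons T x₂ → Incons T (disj x₁ x₂)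
    f-extL   : ∀ {x₁ x₂} → Incons T x₁ → Incons T (ext x₁ x₂)
    f-extR   : ∀ {x₁ x₂} → Incons T x₂ → Incons T (ext x₁ x₂)
    f-parL   : ∀ {A x₁ x₂} → Incons T x₁ → Incons T (par A x₁ x₂)
    f-parR   : ∀ {A x₁ x₂} → Incons T x₂ → Incons T (par A x₁ x₂)
    f-conjL  : ∀ {x₁ x₂} → Incons T x₁ → Incons T (conj x₁ x₂)
    f-conjR  : ∀ {x₁ x₂} → Incons T x₂ → Incons T (conj x₁ x₂)
    f-mismL  : ∀ {a x₁ x₂ y} → Stable T (conj x₁ x₂) →
               T x₁ (vis a) y → (∀ z → ¬ T x₂ (vis a) z) → Incons T (conj x₁ x₂)
    f-mismR  : ∀ {a x₁ x₂ y} → Stable T (conj x₁ x₂) →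
               T x₂ (vis a) y → (∀ z → ¬ T x₁ (vis a) z) → Incons T (conj x₁ x₂)
    f-allSucc : ∀ {α x₁ x₂ z} → T (conj x₁ x₂) α z →
               (∀ y → T (conj x₁ x₂) α y → Incons T y) → Incons T (conj x₁ x₂)
    f-conjWk : ∀ {x₁ x₂} → (∀ y → WeakStable T (conj x₁ x₂) y → Incons T y) →
               Incons T (conj x₁ x₂)
    f-rec    : ∀ {Y tY E} → (Y , tY) ∈ E → Incons T ⟨ tY ∣ E ⟩ → Incons T (rec Y E)
    f-recWk  : ∀ {Y E} → (∀ y → WeakStable T (rec Y E) y → Incons T y) →
               Incons T (rec Y E)

  StableModel : TransRel → (Term → Set) → Set
  StableModel T F =
    (∀ p α q → IsProcess p → (T p α q ⇔ Step T p α q)) ×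
    (∀ p → IsProcess p → (F p ⇔ Incons T p))

-- For □ and ∥ a visible step of the
-- compound either comes from the component that also moved silently (induction)
-- or needs the other component to be stable, contradicting its τ-step; the
-- stable-model property turns that derived τ-step into a transition of the LTS,
-- but only for processes.  So the real work is that processes are closed under
-- taking components and under unfolding ⟨Y | E⟩ to ⟨t_Y | E⟩, and that in a
-- process each Y has a single equation, so both steps of ⟨Y | E⟩ unfold the same t_Y.
module Submission where

open import Defs
open import Data.Bool using (Bool; true; false; _∧_; _∨_; not)
open import Data.Bool.Properties
  using (∧-conicalˡ; ∧-conicalʳ; ∧-zeroʳ; ∧-identityʳ; ∨-zeroʳ; ∨-identityʳ; T-≡)
open import Data.List using ([]; _∷_)
open import Data.List.Membership.Propositional using (_∈_)
open import Data.List.Relation.Unary.Any using (here; there)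
open import Data.Nat using (_≡ᵇ_)
open import Data.Nat.Properties using (≡⇒≡ᵇ)
open import Data.Product using (_,_)
open import Data.Sum using (_⊎_; inj₁; inj₂)
open import Function.Bundles using (Equivalence; _⇔_)
open import Relation.Binary.PropositionalEquality using (_≡_; refl; trans; cong; cong₂)
open import Relation.Nullary using (¬_)

∧-map : ∀ {a b c d} → (a ≡ true → c ≡ true) → (b ≡ true → d ≡ true) →
        a ∧ b ≡ true → c ∧ d ≡ true
∧-map {a} {b} f g e = cong₂ _∧_ (f (∧-conicalˡ a b e)) (g (∧-conicalʳ a b e))

∨-introʳ : ∀ a {b} → b ≡ true → a ∨ b ≡ true
∨-introʳ a e = trans (cong (a ∨_) e) (∨-zeroʳ a)

∨-monoˡ : ∀ {a b} c → (a ≡ true → b ≡ true) → a ∨ c ≡ true → b ∨ c ≡ true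
∨-monoˡ {true}      c f _ = cong (_∨ c) (f refl)
∨-monoˡ {false} {b} c f e = ∨-introʳ b e

∧-mapʳ : ∀ a {b d} → (b ≡ true → d ≡ true) → a ∧ b ≡ true → a ∧ d ≡ true
∧-mapʳ true  f = f
∧-mapʳ false f = λ ()

-- The invariants of the substitution lemmas below, pushed under a binder whose
-- variables are flagged by d.
substitutable-under-binder : ∀ b s k c d → (b ≡ true → s ∧ not k ≡ true ⊎ c ≡ true) →
                             b ∨ d ≡ true → s ∧ not (k ∨ d) ≡ true ⊎ c ∨ d ≡ true
substitutable-under-binder b     s k c true  h e = inj₂ (∨-zeroʳ c)
substitutable-under-binder true  s k c false h e rewrite ∨-identityʳ k | ∨-identityʳ c = h refl
substitutable-under-binder false s k c false h ()

unguarded-under-binder : ∀ b v d → (b ≡ true → v ≡ false) → b ∨ d ≡ true → v ∧ not d ≡ false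
unguarded-under-binder b     v true  h e = ∧-zeroʳ v
unguarded-under-binder true  v false h e = trans (∧-identityʳ v) (h refl)
unguarded-under-binder false v false h ()

module _ {Act : Set} where
  open CLL Act

  mutual
    closedUnder-mono : ∀ {b b′} → (∀ X → b X ≡ true → b′ X ≡ true) →
                       ∀ t → closedUnder b t ≡ true → closedUnder b′ t ≡ true
    closedUnder-mono h nil         = λ _ → refl
    closedUnder-mono h bot         = λ _ → refl
    closedUnder-mono h (pre α t)   = closedUnder-mono h t
    closedUnder-mono h (ext t u)   = ∧-map (closedUnder-mono h t) (closedUnder-mono h u)
    closedUnder-mono h (conj t u)  = ∧-map (closedUnder-mono h t) (closedUnder-mono h u)
    closedUnder-mono h (disj t u)  = ∧-map (closedUnder-mono h t) (closedUnder-mono h u)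
    closedUnder-mono h (par A t u) = ∧-map (closedUnder-mono h t) (closedUnder-mono h u)
    closedUnder-mono h (var X)     = h X
    closedUnder-mono h (rec X E)   =
      closedSpec-mono (λ Y → ∨-monoˡ (Y ∈ᵇ dom E) (h Y)) E

    closedSpec-mono : ∀ {b b′} → (∀ X → b X ≡ true → b′ X ≡ true) →
                      ∀ E → closedSpec b E ≡ true → closedSpec b′ E ≡ true
    closedSpec-mono h []            = λ _ → refl
    closedSpec-mono h ((_ , t) ∷ E) = ∧-map (closedUnder-mono h t) (closedSpec-mono h E)

  dom-subSpec : ∀ E blk E′ → dom (subSpec E blk E′) ≡ dom E′
  dom-subSpec E blk []             = refl
  dom-subSpec E blk ((Y , t) ∷ E′) = cong (Y ∷_) (dom-subSpec E blk E′)

  -- Each free variable of t (flagged by b) is either replaced by the closed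
  -- ⟨X | E⟩ (it is in dom E and not shadowed, blk) or stays bound (flagged by c).
  mutual
    closedUnder-subB : ∀ {E} → closedSpec (_∈ᵇ dom E) E ≡ true →
      ∀ {blk b c} → (∀ X → b X ≡ true → (X ∈ᵇ dom E) ∧ not (blk X) ≡ true ⊎ c X ≡ true) →
      ∀ t → closedUnder b t ≡ true → closedUnder c (subB E blk t) ≡ true
    closedUnder-subB H inv nil         = λ _ → refl
    closedUnder-subB H inv bot         = λ _ → refl
    closedUnder-subB H inv (pre α t)   = closedUnder-subB H inv t
    closedUnder-subB H inv (ext t u)   = ∧-map (closedUnder-subB H inv t) (closedUnder-subB H inv u)
    closedUnder-subB H inv (conj t u)  = ∧-map (closedUnder-subB H inv t) (closedUnder-subB H inv u)
    closedUnder-subB H inv (disj t u)  = ∧-map (closedUnder-subB H inv t) (closedUnder-subB H inv u)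
    closedUnder-subB H inv (par A t u) = ∧-map (closedUnder-subB H inv t) (closedUnder-subB H inv u)
    closedUnder-subB {E} H {blk} {c = c} inv (var X) e
      with (X ∈ᵇ dom E) ∧ not (blk X) | inv X e
    ... | true  | _      = closedSpec-mono (λ Y → ∨-introʳ (c Y)) E H
    ... | false | inj₂ r = r
    closedUnder-subB {E} H {blk} {b} {c} inv (rec X E′)
      rewrite dom-subSpec E (λ Y → blk Y ∨ (Y ∈ᵇ dom E′)) E′ =
      closedSpec-subSpec H
        (λ Y → substitutable-under-binder (b Y) (Y ∈ᵇ dom E) (blk Y) (c Y) (Y ∈ᵇ dom E′) (inv Y)) E′

    closedSpec-subSpec : ∀ {E} → closedSpec (_∈ᵇ dom E) E ≡ true →
      ∀ {blk b c} → (∀ X → b X ≡ true → (X ∈ᵇ dom E) ∧ not (blk X) ≡ true ⊎ c X ≡ true) →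
      ∀ E′ → closedSpec b E′ ≡ true → closedSpec c (subSpec E blk E′) ≡ true
    closedSpec-subSpec H inv []             = λ _ → refl
    closedSpec-subSpec H inv ((_ , t) ∷ E′) =
      ∧-map (closedUnder-subB H inv t) (closedSpec-subSpec H inv E′)

  mutual
    closed⇒guardedIn : ∀ {b V} → (∀ Y → b Y ≡ true → V Y ≡ false) →
                       ∀ t → closedUnder b t ≡ true → guardedIn V t ≡ true
    closed⇒guardedIn h nil         = λ _ → refl
    closed⇒guardedIn h bot         = λ _ → refl
    closed⇒guardedIn h (pre α t)   = λ _ → refl
    closed⇒guardedIn h (disj t u)  = λ _ → refl
    closed⇒guardedIn h (ext t u)   = ∧-map (closed⇒guardedIn h t) (closed⇒guardedIn h u)
    closed⇒guardedIn h (conj t u)  = ∧-map (closed⇒guardedIn h t) (closed⇒guardedIn h u)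
    closed⇒guardedIn h (par A t u) = ∧-map (closed⇒guardedIn h t) (closed⇒guardedIn h u)
    closed⇒guardedIn h (var X) e   = cong not (h X e)
    closed⇒guardedIn {b} {V} h (rec X E) =
      closedSpec⇒guardedSpec (λ Y → unguarded-under-binder (b Y) (V Y) (Y ∈ᵇ dom E) (h Y)) E

    closedSpec⇒guardedSpec : ∀ {b V} → (∀ Y → b Y ≡ true → V Y ≡ false) →
                             ∀ E → closedSpec b E ≡ true → guardedSpec V E ≡ true
    closedSpec⇒guardedSpec h []            = λ _ → refl
    closedSpec⇒guardedSpec h ((_ , t) ∷ E) =
      ∧-map (closed⇒guardedIn h t) (closedSpec⇒guardedSpec h E)

  mutual
    guardedIn-subB : ∀ {E} → closedSpec (_∈ᵇ dom E) E ≡ true → ∀ V blk t →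
                     guardedIn V t ≡ true → guardedIn V (subB E blk t) ≡ true
    guardedIn-subB H V blk nil         = λ _ → refl
    guardedIn-subB H V blk bot         = λ _ → refl
    guardedIn-subB H V blk (pre α t)   = λ _ → refl
    guardedIn-subB H V blk (disj t u)  = λ _ → refl
    guardedIn-subB H V blk (ext t u)   = ∧-map (guardedIn-subB H V blk t) (guardedIn-subB H V blk u)
    guardedIn-subB H V blk (conj t u)  = ∧-map (guardedIn-subB H V blk t) (guardedIn-subB H V blk u)
    guardedIn-subB H V blk (par A t u) = ∧-map (guardedIn-subB H V blk t) (guardedIn-subB H V blk u)
    guardedIn-subB {E} H V blk (var X) e with (X ∈ᵇ dom E) ∧ not (blk X)
    ... | true  =
      closedSpec⇒guardedSpec (λ Y p → trans (cong (λ z → V Y ∧ not z) p) (∧-zeroʳ (V Y))) E H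
    ... | false = e
    guardedIn-subB {E} H V blk (rec X E′)
      rewrite dom-subSpec E (λ Y → blk Y ∨ (Y ∈ᵇ dom E′)) E′ =
      guardedSpec-subSpec H (λ Y → V Y ∧ not (Y ∈ᵇ dom E′)) (λ Y → blk Y ∨ (Y ∈ᵇ dom E′)) E′

    guardedSpec-subSpec : ∀ {E} → closedSpec (_∈ᵇ dom E) E ≡ true → ∀ V blk E′ →
                          guardedSpec V E′ ≡ true → guardedSpec V (subSpec E blk E′) ≡ true
    guardedSpec-subSpec H V blk []             = λ _ → refl
    guardedSpec-subSpec H V blk ((_ , t) ∷ E′) =
      ∧-map (guardedIn-subB H V blk t) (guardedSpec-subSpec H V blk E′)

  record ClosedWfSpec (E : Spec) : Set where
    field
      closed  : closedSpec (_∈ᵇ dom E) E ≡ true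
      nodups  : nodup (dom E) ≡ true
      guarded : guardedSpec (_∈ᵇ dom E) E ≡ true
      wfList  : wfSpecList E ≡ true

  closedWfSpec : ∀ {Y E} → IsProcess (rec Y E) → ClosedWfSpec E
  closedWfSpec {Y} {E} P = record
    { closed  = ∧-conicalˡ cl _ P
    ; nodups  = ∧-conicalˡ nd _ rest
    ; guarded = ∧-conicalˡ g _ (∧-conicalʳ nd _ rest)
    ; wfList  = ∧-conicalʳ g _ (∧-conicalʳ nd _ rest)
    }
    where
    cl nd g : Bool
    cl = closedSpec (_∈ᵇ dom E) E
    nd = nodup (dom E)
    g  = guardedSpec (_∈ᵇ dom E) E
    rest : nd ∧ g ∧ wfSpecList E ≡ true
    rest = ∧-conicalʳ (Y ∈ᵇ dom E) _ (∧-conicalʳ cl _ P)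

  mutual
    wfSpecs-subB : ∀ {E} → ClosedWfSpec E → ∀ blk t →
                   wfSpecs t ≡ true → wfSpecs (subB E blk t) ≡ true
    wfSpecs-subB W blk nil         = λ _ → refl
    wfSpecs-subB W blk bot         = λ _ → refl
    wfSpecs-subB W blk (pre α t)   = wfSpecs-subB W blk t
    wfSpecs-subB W blk (ext t u)   = ∧-map (wfSpecs-subB W blk t) (wfSpecs-subB W blk u)
    wfSpecs-subB W blk (conj t u)  = ∧-map (wfSpecs-subB W blk t) (wfSpecs-subB W blk u)
    wfSpecs-subB W blk (disj t u)  = ∧-map (wfSpecs-subB W blk t) (wfSpecs-subB W blk u)
    wfSpecs-subB W blk (par A t u) = ∧-map (wfSpecs-subB W blk t) (wfSpecs-subB W blk u)
    wfSpecs-subB {E} W blk (var X) _ with (X ∈ᵇ dom E) ∧ not (blk X) in eq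
    ... | true  =
      cong₂ _∧_ (∧-conicalˡ (X ∈ᵇ dom E) _ eq) (cong₂ _∧_ nodups (cong₂ _∧_ guarded wfList))
      where open ClosedWfSpec W
    ... | false = refl
    wfSpecs-subB {E} W blk (rec X E′)
      rewrite dom-subSpec E (λ Y → blk Y ∨ (Y ∈ᵇ dom E′)) E′ =
      ∧-mapʳ (X ∈ᵇ dom E′) (∧-mapʳ (nodup (dom E′))
        (∧-map (guardedSpec-subSpec {E} (ClosedWfSpec.closed W) (_∈ᵇ dom E′) blk′ E′)
               (wfSpecList-subSpec W blk′ E′)))
      where
      blk′ : Var → Bool
      blk′ Y = blk Y ∨ (Y ∈ᵇ dom E′)

    wfSpecList-subSpec : ∀ {E} → ClosedWfSpec E → ∀ blk E′ →
                         wfSpecList E′ ≡ true → wfSpecList (subSpec E blk E′) ≡ true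
    wfSpecList-subSpec W blk []             = λ _ → refl
    wfSpecList-subSpec W blk ((_ , t) ∷ E′) = ∧-map (wfSpecs-subB W blk t) (wfSpecList-subSpec W blk E′)

  closedSpec-∈ : ∀ {b E Y t} → closedSpec b E ≡ true → (Y , t) ∈ E → closedUnder b t ≡ true
  closedSpec-∈ {b} {(_ , u) ∷ _} e (here refl) = ∧-conicalˡ (closedUnder b u) _ e
  closedSpec-∈ {b} {(_ , u) ∷ _} e (there m)   = closedSpec-∈ (∧-conicalʳ (closedUnder b u) _ e) m

  wfSpecList-∈ : ∀ {E Y t} → wfSpecList E ≡ true → (Y , t) ∈ E → wfSpecs t ≡ true
  wfSpecList-∈ {(_ , u) ∷ _} e (here refl) = ∧-conicalˡ (wfSpecs u) _ e
  wfSpecList-∈ {(_ , u) ∷ _} e (there m)   = wfSpecList-∈ (∧-conicalʳ (wfSpecs u) _ e) m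

  head-fresh : ∀ x xs → nodup (x ∷ xs) ≡ true → ¬ (x ∈ᵇ xs ≡ true)
  head-fresh x xs N p with x ∈ᵇ xs
  head-fresh x xs () refl | true

  ∈⇒∈ᵇdom : ∀ {E Y t} → (Y , t) ∈ E → Y ∈ᵇ dom E ≡ true
  ∈⇒∈ᵇdom {_ ∷ E} {Y} (here refl)     = cong (_∨ (Y ∈ᵇ dom E)) (Equivalence.to T-≡ (≡⇒≡ᵇ Y Y refl))
  ∈⇒∈ᵇdom {(Z , _) ∷ _} {Y} (there m) = ∨-introʳ (Y ≡ᵇ Z) (∈⇒∈ᵇdom m)

  nodup⇒equation-unique : ∀ {E Y t t′} → nodup (dom E) ≡ true →
                          (Y , t) ∈ E → (Y , t′) ∈ E → t ≡ t′
  nodup⇒equation-unique N (here refl) (here refl) = refl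
  nodup⇒equation-unique {(Y , _) ∷ E} N (here refl) (there m′)
    with () ← head-fresh Y (dom E) N (∈⇒∈ᵇdom m′)
  nodup⇒equation-unique {(Y , _) ∷ E} N (there m) (here refl)
    with () ← head-fresh Y (dom E) N (∈⇒∈ᵇdom m)
  nodup⇒equation-unique {(Z , _) ∷ E} N (there m) (there m′) =
    nodup⇒equation-unique (∧-conicalʳ (not (Z ∈ᵇ dom E)) _ N) m m′

  isProcess-unfold : ∀ {Y E t} → IsProcess (rec Y E) → (Y , t) ∈ E → IsProcess ⟨ t ∣ E ⟩
  isProcess-unfold {Y} {E} {t} P m = cong₂ _∧_
    (closedUnder-subB closed (λ X p → inj₁ (trans (∧-identityʳ (X ∈ᵇ dom E)) p)) t
      (closedSpec-∈ closed m))
    (wfSpecs-subB W (λ _ → false) t (wfSpecList-∈ wfList m))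
    where
    W = closedWfSpec {Y} {E} P
    open ClosedWfSpec W

  -- Covers the components of □, ∧, ∨ and ∥_A, whose IsProcess unfolds to this shape.
  isProcess-argˡ : ∀ x y → (closedUnder (λ _ → false) x ∧ closedUnder (λ _ → false) y)
                           ∧ (wfSpecs x ∧ wfSpecs y) ≡ true → IsProcess x
  isProcess-argˡ x y =
    ∧-map (∧-conicalˡ (closedUnder (λ _ → false) x) _) (∧-conicalˡ (wfSpecs x) (wfSpecs y))

  isProcess-argʳ : ∀ x y → (closedUnder (λ _ → false) x ∧ closedUnder (λ _ → false) y)
                           ∧ (wfSpecs x ∧ wfSpecs y) ≡ true → IsProcess y
  isProcess-argʳ x y =
    ∧-map (∧-conicalʳ (closedUnder (λ _ → false) x) _) (∧-conicalʳ (wfSpecs x) (wfSpecs y))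

  module _ (T : TransRel) (T⇔Step : ∀ p α q → IsProcess p → (T p α q ⇔ Step T p α q)) where

    step⇒T : ∀ {p α q} → IsProcess p → Step T p α q → T p α q
    step⇒T {p} {α} {q} P = Equivalence.from (T⇔Step p α q P)

    step-τ-pure : ∀ {p q a q′} → IsProcess p → Step T p τ q → ¬ Step T p (vis a) q′
    step-τ-pure {ext x y}   P (r-extτL s) (r-extL s′ _)  = step-τ-pure (isProcess-argˡ x y P) s s′
    step-τ-pure {ext x y}   P (r-extτL s) (r-extR _ st)  = st _ (step⇒T (isProcess-argˡ x y P) s)
    step-τ-pure {ext x y}   P (r-extτR s) (r-extL _ st)  = st _ (step⇒T (isProcess-argʳ x y P) s)
    step-τ-pure {ext x y}   P (r-extτR s) (r-extR s′ _)  = step-τ-pure (isProcess-argʳ x y P) s s′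
    step-τ-pure {conj x y}  P (r-conjτL s) (r-conj s′ _) = step-τ-pure (isProcess-argˡ x y P) s s′
    step-τ-pure {conj x y}  P (r-conjτR s) (r-conj _ s′) = step-τ-pure (isProcess-argʳ x y P) s s′
    step-τ-pure {par A x y} P (r-parτL s) (r-sync _ s′ _) = step-τ-pure (isProcess-argˡ x y P) s s′
    step-τ-pure {par A x y} P (r-parτL s) (r-parL _ s′ _) = step-τ-pure (isProcess-argˡ x y P) s s′
    step-τ-pure {par A x y} P (r-parτL s) (r-parR _ _ st) = st _ (step⇒T (isProcess-argˡ x y P) s)
    step-τ-pure {par A x y} P (r-parτR s) (r-sync _ _ s′) = step-τ-pure (isProcess-argʳ x y P) s s′
    step-τ-pure {par A x y} P (r-parτR s) (r-parL _ _ st) = st _ (step⇒T (isProcess-argʳ x y P) s)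
    step-τ-pure {par A x y} P (r-parτR s) (r-parR _ s′ _) = step-τ-pure (isProcess-argʳ x y P) s s′
    step-τ-pure {rec Y E}   P (r-rec m s) (r-rec m′ s′)
      with refl ← nodup⇒equation-unique (ClosedWfSpec.nodups (closedWfSpec {Y} {E} P)) m m′ =
      step-τ-pure (isProcess-unfold P m) s s′

mainTheorem5 : (Act : Set) → let open CLL Act in
    (T : TransRel) (F : Term → Set) → StableModel T F →
    ∀ p → IsProcess p → ∀ q → T p τ q →
    ∀ (a : Act) q′ → ¬ T p (vis a) q′
mainTheorem5 Act T F (T⇔Step , _) p P q τ-step a q′ a-step =
  step-τ-pure T T⇔Step P (to τ-step) (to a-step)
  where
  open CLL Act using (τ; vis; Step)
  to : ∀ {α r} → T p α r → Step T p α r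
  to {α} {r} = Equivalence.to (T⇔Step p α r P)
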